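{- Let $a(n),b(n),c(n)$ be real polynomials in $n$ of the same degree $\delta$ with positive leading coefficients, taking positive values for all integers $n\ge1$, and let $(u_n)_{n\ge0}$ be a real sequence satisfying $$a(n)u_{n+1}=b(n)u_n-c(n)u_{n-1},\qquad n=1,2,\ldots.$$ For $n\ge 0$ let $Q_n(\lambda)=a(n)\lambda^2-b(n)\lambda+c(n)$. Let $m\ge0$ be an integer and suppose there exists a positive number $\lambda_0$ such that $Q_n(\lambda_0)\le 0$ for all $n\ge m$ and $u_{m+1}\ge\lambda_0u_m>0$. Then $u_n>0$ for all $n\ge m$. -}

module Defs where

open import Level using (0ℓ)
open import Data.Nat using (ℕ; zero; suc)
open import Data.Vec using (Vec; foldr; last)
open import Data.Product using (_×_; ∃)
open import Relation.Nullary using (¬_)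
open import Relation.Binary.Core using (Rel)
open import Relation.Binary.Structures using (IsTotalOrder)
open import Algebra.Bundles using (CommutativeRing)

-- An ordered field (the real numbers are the intended model; agda-stdlib
-- has no reals, so the statement is made for every ordered field).
record OrderedField : Set₁ where
  field
    commutativeRing : CommutativeRing 0ℓ 0ℓ
  open CommutativeRing commutativeRing public
  field
    _≤_          : Rel Carrier 0ℓ
    isTotalOrder : IsTotalOrder _≈_ _≤_
    +-mono-≤     : ∀ {x y} z → x ≤ y → (x + z) ≤ (y + z)
    *-nonneg     : ∀ {x y} → 0# ≤ x → 0# ≤ y → 0# ≤ (x * y)
    0≉1          : ¬ (0# ≈ 1#)
    inverse      : ∀ x → ¬ (x ≈ 0#) → ∃ λ y → (x * y) ≈ 1#

  _<_ : Rel Carrier 0ℓ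
  x < y = (x ≤ y) × ¬ (x ≈ y)

  ι : ℕ → Carrier
  ι zero    = 0#
  ι (suc n) = 1# + ι n

  -- A polynomial of degree exactly δ is given by its coefficient vector
  -- (c₀, c₁, …, c_δ) (ascending powers); its leading coefficient is c_δ.
  Poly : ℕ → Set
  Poly δ = Vec Carrier (suc δ)

  leading : ∀ {δ} → Poly δ → Carrier
  leading p = last p

  eval : ∀ {δ} → Poly δ → Carrier → Carrier
  eval p x = foldr _ (λ c acc → c + (x * acc)) 0# p

  evalℕ : ∀ {δ} → Poly δ → ℕ → Carrier
  evalℕ p n = eval p (ι n)

{-# OPTIONS --safe #-}
-- Q_n(λ) ≤ 0 says λ (b(n) − a(n) λ) ≥ c(n) > 0, so b(n) − a(n) λ > 0. Writing the
-- recurrence as a(n) (u_{n+1} − λ u_n) = (b(n) − a(n) λ) u_n − c(n) u_{n−1}, the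
-- invariant u_n ≥ λ u_{n−1} > 0 gives (b(n) − a(n) λ) u_n ≥ λ (b(n) − a(n) λ) u_{n−1}
-- ≥ c(n) u_{n−1}, hence u_{n+1} ≥ λ u_n ≥ λ² u_{n−1} > 0: the invariant propagates.
module Submission where

open import Defs
open import Data.Nat using (ℕ; suc; _≤′_; ≤′-reflexive; ≤′-step; s≤s)
  renaming (_≤_ to _≤ℕ_; _<_ to _<ℕ_)
open import Data.Nat.Properties using (≤′⇒≤; ≤⇒≤′; <⇒≤; m<n⇒0<n)
open import Data.Product using (_×_; _,_; proj₁; proj₂)
open import Data.Sum using (inj₁; inj₂)
open import Relation.Nullary using (¬_)
open import Relation.Binary.PropositionalEquality using (refl)
open import Relation.Binary.Structures using (IsTotalOrder)
open import Relation.Binary.Bundles using (Poset)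
open import Level using (0ℓ)
import Relation.Binary.Reasoning.Setoid
import Relation.Binary.Reasoning.PartialOrder

module OrderedFieldProperties (F : OrderedField) where
  open OrderedField F
  open IsTotalOrder isTotalOrder
    using (total; antisym; ≤-respˡ-≈; ≤-respʳ-≈)
    renaming (reflexive to ≤-reflexive; trans to ≤-trans)
  open import Algebra.Properties.Ring ring using (x[y-z]≈xy-xz; [y-z]x≈yx-zx)
  open import Algebra.Properties.AbelianGroup +-abelianGroup using (⁻¹-anti-homo‿-; ⁻¹-∙-comm)
  open import Algebra.Properties.CommutativeSemigroup +-commutativeSemigroup using (xy∙z≈xz∙y)
  open import Algebra.Properties.CommutativeSemigroup *-commutativeSemigroup
    using (x∙yz≈y∙xz; xy∙z≈y∙xz)

  poset : Poset 0ℓ 0ℓ 0ℓ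
  poset = record { isPartialOrder = IsTotalOrder.isPartialOrder isTotalOrder }

  module ≈-Reasoning = Relation.Binary.Reasoning.Setoid setoid
  module ≤-Reasoning = Relation.Binary.Reasoning.PartialOrder poset

  x≤y⇒0≤y-x : ∀ {x y} → x ≤ y → 0# ≤ (y - x)
  x≤y⇒0≤y-x {x} x≤y = ≤-respˡ-≈ (-‿inverseʳ x) (+-mono-≤ (- x) x≤y)

  0≤y-x⇒x≤y : ∀ {x y} → 0# ≤ (y - x) → x ≤ y
  0≤y-x⇒x≤y {x} {y} 0≤y-x = ≤-respʳ-≈ y-x+x≈y (≤-respˡ-≈ (+-identityˡ x) (+-mono-≤ x 0≤y-x))
    where
    y-x+x≈y : (y - x) + x ≈ y
    y-x+x≈y = trans (+-assoc y (- x) x) (trans (+-congˡ (-‿inverseˡ x)) (+-identityʳ y))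

  *-monoʳ-≤-nonNeg : ∀ {x y z} → 0# ≤ z → x ≤ y → (z * x) ≤ (z * y)
  *-monoʳ-≤-nonNeg {x} {y} {z} 0≤z x≤y =
    0≤y-x⇒x≤y (≤-respʳ-≈ (x[y-z]≈xy-xz z y x) (*-nonneg 0≤z (x≤y⇒0≤y-x x≤y)))

  <-≤-trans : ∀ {x y z} → x < y → y ≤ z → x < z
  <-≤-trans (x≤y , x≉y) y≤z =
    ≤-trans x≤y y≤z , λ x≈z → x≉y (antisym x≤y (≤-respʳ-≈ (sym x≈z) y≤z))

  0<x⇒x≉0 : ∀ {x} → 0# < x → ¬ (x ≈ 0#)
  0<x⇒x≉0 (_ , 0≉x) x≈0 = 0≉x (sym x≈0)

  x≉0⇒x*y≈0⇒y≈0 : ∀ {x y} → ¬ (x ≈ 0#) → x * y ≈ 0# → y ≈ 0#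
  x≉0⇒x*y≈0⇒y≈0 {x} {y} x≉0 xy≈0 with inverse x x≉0
  ... | x⁻¹ , xx⁻¹≈1 = begin
    y              ≈⟨ *-identityˡ y ⟨
    1# * y         ≈⟨ *-congʳ xx⁻¹≈1 ⟨
    (x * x⁻¹) * y  ≈⟨ xy∙z≈y∙xz x x⁻¹ y ⟩
    x⁻¹ * (x * y)  ≈⟨ *-congˡ xy≈0 ⟩
    x⁻¹ * 0#       ≈⟨ zeroʳ x⁻¹ ⟩
    0#             ∎
    where open ≈-Reasoning

  pos*pos⇒pos : ∀ {x y} → 0# < x → 0# < y → 0# < (x * y)
  pos*pos⇒pos 0<x 0<y = *-nonneg (proj₁ 0<x) (proj₁ 0<y) ,
    λ 0≈xy → 0<x⇒x≉0 0<y (x≉0⇒x*y≈0⇒y≈0 (0<x⇒x≉0 0<x) (sym 0≈xy))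

  0≤a*x⇒0≤x : ∀ {a x} → 0# < a → 0# ≤ (a * x) → 0# ≤ x
  0≤a*x⇒0≤x {a} {x} 0<a 0≤ax with total 0# x
  ... | inj₁ 0≤x = 0≤x
  ... | inj₂ x≤0 = ≤-reflexive (sym (x≉0⇒x*y≈0⇒y≈0 (0<x⇒x≉0 0<a) (antisym ax≤0 0≤ax)))
    where
    ax≤0 : (a * x) ≤ 0#
    ax≤0 = ≤-respʳ-≈ (zeroʳ a) (*-monoʳ-≤-nonNeg (proj₁ 0<a) x≤0)

  0<a*x⇒0<x : ∀ {a x} → 0# < a → 0# < (a * x) → 0# < x
  0<a*x⇒0<x {a} 0<a (0≤ax , 0≉ax) =
    0≤a*x⇒0≤x 0<a 0≤ax , λ 0≈x → 0≉ax (sym (trans (*-congˡ (sym 0≈x)) (zeroʳ a)))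

  -[al²-bl+c]≈l[b-al]-c : ∀ a b c l →
    - (((a * (l * l)) - (b * l)) + c) ≈ (l * (b - a * l)) - c
  -[al²-bl+c]≈l[b-al]-c a b c l = begin
    - (((a * (l * l)) - (b * l)) + c)  ≈⟨ ⁻¹-∙-comm _ _ ⟨
    - ((a * (l * l)) - (b * l)) - c    ≈⟨ +-congʳ (⁻¹-anti-homo‿- _ _) ⟩
    ((b * l) - (a * (l * l))) - c      ≈⟨ +-congʳ (+-cong (*-comm l b) (-‿cong (x∙yz≈y∙xz l a l))) ⟨
    ((l * b) - (l * (a * l))) - c      ≈⟨ +-congʳ (x[y-z]≈xy-xz l b (a * l)) ⟨
    (l * (b - a * l)) - c              ∎
    where open ≈-Reasoning

  [b-al]q-cp≈bq-cp-a[lq] : ∀ a b c l p q →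
    ((b - a * l) * q) - (c * p) ≈ ((b * q) - (c * p)) - (a * (l * q))
  [b-al]q-cp≈bq-cp-a[lq] a b c l p q = begin
    ((b - a * l) * q) - (c * p)          ≈⟨ +-congʳ ([y-z]x≈yx-zx q b (a * l)) ⟩
    ((b * q) - ((a * l) * q)) - (c * p)  ≈⟨ +-congʳ (+-congˡ (-‿cong (*-assoc a l q))) ⟩
    ((b * q) - (a * (l * q))) - (c * p)  ≈⟨ xy∙z≈xz∙y _ _ _ ⟩
    ((b * q) - (c * p)) - (a * (l * q))  ∎
    where open ≈-Reasoning

  RatioAtLeast : Carrier → Carrier → Carrier → Set
  RatioAtLeast l p q = ((l * p) ≤ q) × (0# < (l * p))

  ratioAtLeast-step : ∀ {a b c l p q r} → 0# < a → 0# < c → 0# < l →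
    (((a * (l * l)) - (b * l)) + c) ≤ 0# →
    a * r ≈ (b * q) - (c * p) →
    RatioAtLeast l p q → RatioAtLeast l q r
  ratioAtLeast-step {a} {b} {c} {l} {p} {q} {r} 0<a 0<c 0<l Q≤0 recurrence (lp≤q , 0<lp) =
    lq≤r , <-≤-trans (pos*pos⇒pos 0<l 0<lp) (*-monoʳ-≤-nonNeg (proj₁ 0<l) lp≤q)
    where
    d : Carrier
    d = b - a * l

    c≤ld : c ≤ (l * d)
    c≤ld = 0≤y-x⇒x≤y (≤-respʳ-≈ (trans (+-identityˡ _) (-[al²-bl+c]≈l[b-al]-c a b c l))
                                  (x≤y⇒0≤y-x Q≤0))

    0<d : 0# < d
    0<d = 0<a*x⇒0<x 0<l (<-≤-trans 0<c c≤ld)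

    cp≤dq : (c * p) ≤ (d * q)
    cp≤dq = begin
      c * p        ≈⟨ *-comm c p ⟩
      p * c        ≤⟨ *-monoʳ-≤-nonNeg (proj₁ (0<a*x⇒0<x 0<l 0<lp)) c≤ld ⟩
      p * (l * d)  ≈⟨ *-comm p (l * d) ⟩
      (l * d) * p  ≈⟨ xy∙z≈y∙xz l d p ⟩
      d * (l * p)  ≤⟨ *-monoʳ-≤-nonNeg (proj₁ 0<d) lp≤q ⟩
      d * q        ∎
      where open ≤-Reasoning

    a[r-lq]≈dq-cp : a * (r - l * q) ≈ (d * q) - (c * p)
    a[r-lq]≈dq-cp = begin
      a * (r - l * q)                    ≈⟨ x[y-z]≈xy-xz a r (l * q) ⟩
      (a * r) - (a * (l * q))            ≈⟨ +-congʳ recurrence ⟩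
      ((b * q) - (c * p)) - (a * (l * q)) ≈⟨ [b-al]q-cp≈bq-cp-a[lq] a b c l p q ⟨
      (d * q) - (c * p)                  ∎
      where open ≈-Reasoning

    lq≤r : (l * q) ≤ r
    lq≤r = 0≤y-x⇒x≤y (0≤a*x⇒0≤x 0<a (≤-respʳ-≈ (sym a[r-lq]≈dq-cp) (x≤y⇒0≤y-x cp≤dq)))

  ratioAtLeast-recurrence : (α β γ u : ℕ → Carrier) →
    (∀ k → α (suc k) * u (suc (suc k)) ≈ (β (suc k) * u (suc k)) - (γ (suc k) * u k)) →
    (m : ℕ) (l : Carrier) → 0# < l →
    (∀ n → m <ℕ n → 0# < α n) → (∀ n → m <ℕ n → 0# < γ n) →
    (∀ n → m <ℕ n → (((α n * (l * l)) - (β n * l)) + γ n) ≤ 0#) →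
    RatioAtLeast l (u m) (u (suc m)) →
    ∀ {n} → m ≤′ n → RatioAtLeast l (u n) (u (suc n))
  ratioAtLeast-recurrence α β γ u recurrence m l 0<l 0<α 0<γ Q≤0 base = go
    where
    go : ∀ {n} → m ≤′ n → RatioAtLeast l (u n) (u (suc n))
    go (≤′-reflexive refl) = base
    go {suc n} (≤′-step m≤′n) =
      ratioAtLeast-step (0<α (suc n) m<1+n) (0<γ (suc n) m<1+n) 0<l (Q≤0 (suc n) m<1+n)
        (recurrence n) (go m≤′n)
      where
      m<1+n : m <ℕ suc n
      m<1+n = s≤s (≤′⇒≤ m≤′n)

theorem1p4 : (F : OrderedField) → let open OrderedField F in
    (δ : ℕ) (a b c : Poly δ) →
    0# < leading a → 0# < leading b → 0# < leading c →
    (∀ n → 1 ≤ℕ n → 0# < evalℕ a n) →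
    (∀ n → 1 ≤ℕ n → 0# < evalℕ b n) →
    (∀ n → 1 ≤ℕ n → 0# < evalℕ c n) →
    (u : ℕ → Carrier) →
    (∀ k → (evalℕ a (suc k) * u (suc (suc k)))
             ≈ ((evalℕ b (suc k) * u (suc k)) - (evalℕ c (suc k) * u k))) →
    (m : ℕ) (λ₀ : Carrier) → 0# < λ₀ →
    (∀ n → m ≤ℕ n →
       (((evalℕ a n * (λ₀ * λ₀)) - (evalℕ b n * λ₀)) + evalℕ c n) ≤ 0#) →
    (λ₀ * u m) ≤ u (suc m) →
    0# < (λ₀ * u m) →
    ∀ n → m ≤ℕ n → 0# < u n
-- The degree, the leading coefficients and the positivity of b are not needed.
theorem1p4 F δ a b c _ _ _ 0<a _ 0<c u recurrence m λ₀ 0<λ₀ Q≤0 λ₀u≤u′ 0<λ₀u n m≤n =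
  0<a*x⇒0<x 0<λ₀ (proj₂ (ratioAtLeast-from-m (≤⇒≤′ m≤n)))
  where
  open OrderedField F
  open OrderedFieldProperties F

  ratioAtLeast-from-m : ∀ {n} → m ≤′ n → RatioAtLeast λ₀ (u n) (u (suc n))
  ratioAtLeast-from-m = ratioAtLeast-recurrence (evalℕ a) (evalℕ b) (evalℕ c) u recurrence
    m λ₀ 0<λ₀
    (λ n m<n → 0<a n (m<n⇒0<n m<n))
    (λ n m<n → 0<c n (m<n⇒0<n m<n))
    (λ n m<n → Q≤0 n (<⇒≤ m<n))
    (λ₀u≤u′ , 0<λ₀u)
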